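{- For every integer $k\ge1$ and every strict partition $\lambda$, $$\psi_k(\lambda)=\sum_{i=1}^{\ell(\lambda)}\lambda_i^k\big\{(\lambda_i+1)^k-(\lambda_i-1)^k\big\}=2\sum_{\substack{1\le s\le k\\ s\ \mathrm{odd}}}\binom{k}{s}p_{2k-s}(\lambda).$$ In particular, $\psi_k$ is a supersymmetric function (it is the evaluation of an element of $\Gamma$).
   Context: A strict partition is a strictly decreasing finite sequence $\lambda=(\lambda_1,\dots,\lambda_l)$ of positive integers (including $\emptyset$), $\ell(\lambda)=l$. Its shifted Young diagram is $S(\lambda)=\{(i,j)\in\mathbb{Z}^2:1\le i\le\ell(\lambda),\ i\le j\le\lambda_i+i-1\}$, and for $\square=(i,j)\in\mathbb{Z}^2$ set $c_\square=j-i$. A box $\square\in S(\lambda)$ is an outer corner of $\lambda$ if $S(\lambda)\setminus\{\square\}$ is the shifted diagram of a strict partition; a box $\square\notin S(\lambda)$ is an inner corner if $S(\lambda)\cup\{\square\}$ is the shifted diagram of a strict partition. $\mathbb{O}_\lambda$, $\mathbb{I}_\lambda$ denote the sets of outer and inner corners, and $\psi_k(\lambda)=\sum_{\square\in\mathbb{I}_\lambda}\{c_\square(c_\square+1)\}^k-\sum_{\square\in\mathbb{O}_\lambda}\{c_\square(c_\square+1)\}^k$. $p_r(\lambda)=\lambda_1^r+\cdots+\lambda_{\ell(\lambda)}^r$; $\Gamma$ is the $\mathbb{Q}$-subalgebra of symmetric functions generated by the odd power sums $p_1,p_3,p_5,\dots$, evaluated at $\lambda$ by setting $x_i=\lambda_i$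 for $i\le\ell(\lambda)$ and $x_i=0$ otherwise. -}

module Defs where

open import Data.Nat as ℕ using (ℕ; zero; suc; _%_)
open import Data.Nat.Combinatorics using (_C_)
open import Data.Integer as ℤ using (ℤ; +_; _-_; _*_; _^_)
open import Data.Fin using (Fin; toℕ)
open import Data.List using (List; []; _∷_; length; lookup; map; foldr; filter; upTo)
open import Data.List.Relation.Unary.All using (All)
open import Data.List.Relation.Unary.Linked using (Linked)
open import Data.List.Relation.Unary.Unique.Propositional using (Unique)
open import Data.List.Membership.Propositional using (_∈_)
open import Data.Product using (Σ; _×_; _,_)
open import Data.Sum using (_⊎_)
open import Relation.Nullary using (¬_)
open import Relation.Binary.PropositionalEquality using (_≡_; _≢_)
open import Function.Bundles using (_⇔_)
open import Data.Nat.Properties using (_≟_)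

record StrictPartition : Set where
  constructor sp
  field
    parts      : List ℕ
    decreasing : Linked ℕ._>_ parts
    positive   : All (λ x → 0 ℕ.< x) parts
open StrictPartition public

len : StrictPartition → ℕ
len λ' = length (parts λ')

Box : Set
Box = ℤ × ℤ

-- membership in the shifted Young diagram S(λ):
-- 1 ≤ i ≤ ℓ(λ) and i ≤ j ≤ λ_i + i - 1   (λ_i = lookup parts (i-1))
InS : StrictPartition → Box → Set
InS λ' (i , j) =
  Σ (Fin (len λ')) λ n →
    (i ≡ + suc (toℕ n)) × (i ℤ.≤ j) × (j ℤ.≤ (+ lookup (parts λ') n) ℤ.+ i - + 1)

IsOuterCorner : StrictPartition → Box → Set
IsOuterCorner λ' b =
  InS λ' b × Σ StrictPartition λ μ → ∀ c → InS μ c ⇔ (InS λ' c × c ≢ b)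

IsInnerCorner : StrictPartition → Box → Set
IsInnerCorner λ' b =
  ¬ InS λ' b × Σ StrictPartition λ μ → ∀ c → InS μ c ⇔ (InS λ' c ⊎ c ≡ b)

-- a duplicate-free list enumerating exactly the boxes satisfying P (a finite set)
Enumerates : (Box → Set) → List Box → Set
Enumerates P xs = Unique xs × (∀ b → b ∈ xs ⇔ P b)

sumℤ : List ℤ → ℤ
sumℤ = foldr ℤ._+_ (+ 0)

content : Box → ℤ
content (i , j) = j - i

cornerWeight : ℕ → Box → ℤ
cornerWeight k b = (content b * (content b ℤ.+ + 1)) ^ k

-- ψ_k(λ) computed from enumerations I of 𝕀_λ and O of 𝕆_λ
ψ : ℕ → List Box → List Box → ℤ
ψ k I O = sumℤ (map (cornerWeight k) I) - sumℤ (map (cornerWeight k) O)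

middleSum : ℕ → StrictPartition → ℤ
middleSum k λ' =
  sumℤ (map (λ x → (+ x) ^ k * ((+ x ℤ.+ + 1) ^ k - (+ x - + 1) ^ k)) (parts λ'))

p : ℕ → StrictPartition → ℤ
p r λ' = sumℤ (map (λ x → (+ x) ^ r) (parts λ'))

oddsUpTo : ℕ → List ℕ
oddsUpTo k = filter (λ s → s % 2 ≟ 1) (upTo (suc k))

powerSumExpr : ℕ → StrictPartition → ℤ
powerSumExpr k λ' =
  + 2 * sumℤ (map (λ s → + (k C s) * p (2 ℕ.* k ℕ.∸ s) λ') (oddsUpTo k))

-- Let λ_r be the length of row r of λ, counting rows from 0 and with λ_r = 0 for r ≥ ℓ(λ).
-- The inner corners of λ are the boxes just after row r, for r = 0 and for the r ≤ ℓ(λ)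
-- with λ_{r-1} ≥ λ_r + 2; their content is λ_r.  The outer corners are the last boxes of
-- the rows r < ℓ(λ) with λ_{r+1} = 0 or λ_r ≥ λ_{r+1} + 2; their content is λ_r - 1.
-- With W(t) = (t(t+1))^k, whichever of the inner corner of row r + 1 and the outer corner
-- of row r exist contribute W(λ_{r+1}) - W(λ_r - 1) to ψ_k(λ) together (W(0) = 0 as
-- k ≥ 1), so ψ_k(λ) telescopes to Σ_r (W(λ_r) - W(λ_r - 1)), and
-- W(m) - W(m - 1) = m^k ((m+1)^k - (m-1)^k).  Expanding (m ± 1)^k by the binomial
-- theorem, the terms of even index cancel and those of odd index double.

module Submission where

open import Defs
open import Data.Nat as ℕ using (ℕ; zero; suc; pred; _∸_; _%_; _≤_; _<_; _≥_; z≤n; s≤s)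
open import Data.Nat.Properties as ℕP using (_≟_)
open import Data.Nat.Combinatorics using (_C_)
open import Data.Integer as ℤ using (ℤ; +_; -[1+_]; 1ℤ; -1ℤ; _+_; _-_; _*_; _^_; +≤+)
import Data.Integer.Properties as ℤP
open import Data.Integer.Tactic.RingSolver using (solve-∀)
open import Data.Fin as Fin using (Fin; toℕ; fromℕ<)
open import Data.Fin.Properties using (toℕ-fromℕ<; toℕ≤pred[n])
open import Data.Vec.Functional using (Vector)
open import Data.List using (List; []; _∷_; map; filter; length; lookup; upTo; applyUpTo)
open import Data.List.Properties using (map-cong; map-∘)
open import Data.List.Relation.Unary.All using (All; []; _∷_)
open import Data.List.Relation.Unary.Linked using (Linked; []; [-]; _∷_)
open import Data.List.Membership.Propositional using (_∈_)
open import Data.List.Membership.Propositional.Properties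
  using (∈-map∘filter⁻; ∈-map∘filter⁺; ∈-upTo⁺)
open import Data.List.Membership.Propositional.Properties.WithK using (unique∧set⇒bag)
open import Data.List.Relation.Binary.BagAndSetEquality using (∼bag⇒↭)
open import Data.List.Relation.Binary.Permutation.Propositional using (_↭_; ↭⇒↭ₛ)
import Data.List.Relation.Binary.Permutation.Propositional.Properties as ↭
open import Data.List.Relation.Binary.Permutation.Setoid.Properties using (foldr-commMonoid)
import Data.List.Relation.Unary.Unique.Propositional.Properties as Unique
open import Data.Product using (Σ; ∃₂; _×_; _,_; proj₁; proj₂)
open import Data.Sum using (_⊎_; inj₁; inj₂; [_,_]′)
open import Data.Empty using (⊥-elim)
open import Data.Unit using (⊤; tt)
open import Relation.Nullary using (Dec; yes; no; ¬_)
open import Relation.Binary.Definitions using (tri<; tri≈; tri>)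
open import Relation.Nullary.Decidable using (_×-dec_; _⊎-dec_)
open import Relation.Unary using (Pred; Decidable)
open import Relation.Binary.PropositionalEquality
open import Function using (_∘_; id; flip)
open import Function.Bundles using (mk⇔; Equivalence)
import Function.Properties.Equivalence as ⇔
open import Algebra.Bundles using (CommutativeMonoid)
open import Algebra.Properties.CommutativeMonoid.Sum ℤP.+-0-commutativeMonoid
  using (sum; sum-syntax; sum⁺-syntax; sum-cong-≗)
open import Algebra.Properties.Semiring.Sum ℤP.+-*-semiring using (*-distribˡ-sum)
open import Algebra.Properties.Semiring.Mult ℤP.+-*-semiring using () renaming (_×_ to _×ˢ_)
open import Algebra.Properties.Semiring.Exp ℤP.+-*-semiring using () renaming (_^_ to _^ˢ_)
import Algebra.Properties.CommutativeSemiring.Exp ℤP.+-*-commutativeSemiring as Exp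
import Algebra.Properties.CommutativeSemiring.Binomial ℤP.+-*-commutativeSemiring as Binomial

open ≡-Reasoning

-- The library's binomial theorem is stated with the semiring-generic power and multiple.

^ˢ≡^ : ∀ x n → x ^ˢ n ≡ x ^ n
^ˢ≡^ x zero    = refl
^ˢ≡^ x (suc n) = cong (x *_) (^ˢ≡^ x n)

^-distrib-* : ∀ x y n → (x * y) ^ n ≡ x ^ n * y ^ n
^-distrib-* x y n = begin
  (x * y) ^ n        ≡⟨ sym (^ˢ≡^ (x * y) n) ⟩
  (x * y) ^ˢ n       ≡⟨ Exp.^-distrib-* x y n ⟩
  x ^ˢ n * y ^ˢ n    ≡⟨ cong₂ _*_ (^ˢ≡^ x n) (^ˢ≡^ y n) ⟩
  x ^ n * y ^ n      ∎

×ˢ≡* : ∀ n x → n ×ˢ x ≡ + n * x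
×ˢ≡* zero    x = sym (ℤP.*-zeroˡ x)
×ˢ≡* (suc n) x = trans (cong (_+_ x) (×ˢ≡* n x)) (sym (ℤP.suc-* (+ n) x))

binomial : ∀ n x y → (x + y) ^ n ≡ ∑[ s ≤ n ] (+ (n C toℕ s) * (x ^ toℕ s * y ^ (n ∸ toℕ s)))
binomial n x y = begin
  (x + y) ^ n                        ≡⟨ sym (^ˢ≡^ (x + y) n) ⟩
  (x + y) ^ˢ n                       ≡⟨ Binomial.theorem n x y ⟩
  Binomial.binomialExpansion x y n   ≡⟨ sum-cong-≗ {suc n} term ⟩
  ∑[ s ≤ n ] (+ (n C toℕ s) * (x ^ toℕ s * y ^ (n ∸ toℕ s))) ∎
  where
  term : ∀ s → (n C toℕ s) ×ˢ (x ^ˢ toℕ s * y ^ˢ (n ∸ toℕ s))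
             ≡ + (n C toℕ s) * (x ^ toℕ s * y ^ (n ∸ toℕ s))
  term s = trans (×ˢ≡* (n C toℕ s) _)
                 (cong₂ (λ a b → + (n C toℕ s) * (a * b)) (^ˢ≡^ x (toℕ s)) (^ˢ≡^ y (n ∸ toℕ s)))

∑-distrib-− : ∀ n (f g : Vector ℤ n) → ∑[ i < n ] (f i - g i) ≡ sum f - sum g
∑-distrib-− zero    f g = refl
∑-distrib-− (suc n) f g = begin
  f Fin.zero - g Fin.zero + ∑[ i < n ] (f (Fin.suc i) - g (Fin.suc i))
    ≡⟨ cong (_+_ (f Fin.zero - g Fin.zero)) (∑-distrib-− n (f ∘ Fin.suc) (g ∘ Fin.suc)) ⟩
  f Fin.zero - g Fin.zero + (sum (f ∘ Fin.suc) - sum (g ∘ Fin.suc))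
    ≡⟨ interchange (f Fin.zero) (g Fin.zero) (sum (f ∘ Fin.suc)) (sum (g ∘ Fin.suc)) ⟩
  f Fin.zero + sum (f ∘ Fin.suc) - (g Fin.zero + sum (g ∘ Fin.suc)) ∎
  where
  interchange : ∀ a b c d → a - b + (c - d) ≡ a + c - (b + d)
  interchange = solve-∀

∑-telescope : ∀ n (f g : ℕ → ℤ) →
  f 0 + ∑[ r < n ] (f (suc (toℕ r)) - g (toℕ r)) ≡ ∑[ r < n ] (f (toℕ r) - g (toℕ r)) + f n
∑-telescope zero    f g = ℤP.+-comm (f 0) (+ 0)
∑-telescope (suc n) f g = begin
  f 0 + (f 1 - g 0 + S)                ≡⟨ regroup (f 0) (f 1) (g 0) S ⟩
  f 0 - g 0 + (f 1 + S)                ≡⟨ cong (_+_ (f 0 - g 0)) (∑-telescope n (f ∘ suc) (g ∘ suc)) ⟩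
  f 0 - g 0 + (T + f (suc n))          ≡⟨ sym (ℤP.+-assoc (f 0 - g 0) T (f (suc n))) ⟩
  f 0 - g 0 + T + f (suc n)            ∎
  where
  S = ∑[ r < n ] (f (suc (suc (toℕ r))) - g (suc (toℕ r)))
  T = ∑[ r < n ] (f (suc (toℕ r)) - g (suc (toℕ r)))
  regroup : ∀ a b c d → a + (b - c + d) ≡ a - c + (b + d)
  regroup = solve-∀

sumℤ-applyUpTo : ∀ (f : ℕ → ℤ) g n → sumℤ (map f (applyUpTo g n)) ≡ ∑[ i < n ] f (g (toℕ i))
sumℤ-applyUpTo f g zero    = refl
sumℤ-applyUpTo f g (suc n) = cong (_+_ (f (g 0))) (sumℤ-applyUpTo f (g ∘ suc) n)

sumℤ-↭ : ∀ {xs ys} → xs ↭ ys → sumℤ xs ≡ sumℤ ys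
sumℤ-↭ xs↭ys = foldr-commMonoid ℤ+.setoid ℤ+.isCommutativeMonoid (↭⇒↭ₛ xs↭ys)
  where module ℤ+ = CommutativeMonoid ℤP.+-0-commutativeMonoid

when : ∀ {p} {P : Set p} → Dec P → ℤ → ℤ
when (yes _) z = z
when (no _)  _ = + 0

sumℤ-filter : ∀ {a p} {A : Set a} {P : Pred A p} (P? : Decidable P) (f : A → ℤ) xs →
  sumℤ (map f (filter P? xs)) ≡ sumℤ (map (λ x → when (P? x) (f x)) xs)
sumℤ-filter P? f []       = refl
sumℤ-filter P? f (x ∷ xs) with P? x
... | yes _ = cong (_+_ (f x)) (sumℤ-filter P? f xs)
... | no _  = trans (sumℤ-filter P? f xs) (sym (ℤP.+-identityˡ _))

sumℤ-filter-upTo : ∀ {p} {P : Pred ℕ p} (P? : Decidable P) (f : ℕ → ℤ) n →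
  sumℤ (map f (filter P? (upTo n))) ≡ ∑[ i < n ] (when (P? (toℕ i)) (f (toℕ i)))
sumℤ-filter-upTo P? f n = trans (sumℤ-filter P? f (upTo n)) (sumℤ-applyUpTo _ id n)

sumℤ-*ˡ : ∀ {A : Set} c (f : A → ℤ) xs → sumℤ (map (λ x → c * f x) xs) ≡ c * sumℤ (map f xs)
sumℤ-*ˡ c f []       = sym (ℤP.*-zeroʳ c)
sumℤ-*ˡ c f (x ∷ xs) = begin
  c * f x + sumℤ (map (λ x → c * f x) xs)  ≡⟨ cong (_+_ (c * f x)) (sumℤ-*ˡ c f xs) ⟩
  c * f x + c * sumℤ (map f xs)            ≡⟨ sym (ℤP.*-distribˡ-+ c (f x) _) ⟩
  c * (f x + sumℤ (map f xs))              ∎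

sumℤ-+ : ∀ {A : Set} (f g : A → ℤ) xs →
  sumℤ (map (λ x → f x + g x) xs) ≡ sumℤ (map f xs) + sumℤ (map g xs)
sumℤ-+ f g []       = refl
sumℤ-+ f g (x ∷ xs) = begin
  f x + g x + sumℤ (map (λ x → f x + g x) xs)          ≡⟨ cong (_+_ (f x + g x)) (sumℤ-+ f g xs) ⟩
  f x + g x + (sumℤ (map f xs) + sumℤ (map g xs))      ≡⟨ interchange (f x) (g x) (sumℤ (map f xs)) _ ⟩
  f x + sumℤ (map f xs) + (g x + sumℤ (map g xs))      ∎
  where
  interchange : ∀ a b c d → a + b + (c + d) ≡ a + c + (b + d)
  interchange = solve-∀

sumℤ-0 : ∀ {A : Set} (xs : List A) → sumℤ (map (λ _ → + 0) xs) ≡ + 0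
sumℤ-0 []       = refl
sumℤ-0 (_ ∷ xs) = trans (ℤP.+-identityˡ _) (sumℤ-0 xs)

sumℤ-comm : ∀ {A B : Set} (f : A → B → ℤ) xs ys →
  sumℤ (map (λ x → sumℤ (map (f x) ys)) xs) ≡ sumℤ (map (λ y → sumℤ (map (λ x → f x y) xs)) ys)
sumℤ-comm f []       ys = sym (sumℤ-0 ys)
sumℤ-comm f (x ∷ xs) ys = begin
  sumℤ (map (f x) ys) + sumℤ (map (λ x → sumℤ (map (f x) ys)) xs)
    ≡⟨ cong (_+_ (sumℤ (map (f x) ys))) (sumℤ-comm f xs ys) ⟩
  sumℤ (map (f x) ys) + sumℤ (map (λ y → sumℤ (map (λ x → f x y) xs)) ys)
    ≡⟨ sym (sumℤ-+ (f x) _ ys) ⟩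
  sumℤ (map (λ y → sumℤ (map (λ x → f x y) (x ∷ xs))) ys) ∎

enumerations-sum : ∀ {P : Box → Set} (w : Box → ℤ) {bs cs} →
  Enumerates P bs → Enumerates P cs → sumℤ (map w bs) ≡ sumℤ (map w cs)
enumerations-sum w (bs! , bs⇔P) (cs! , cs⇔P) =
  sumℤ-↭ (↭.map⁺ w (∼bag⇒↭ (unique∧set⇒bag bs! cs! λ {b} → ⇔.trans (bs⇔P b) (⇔.sym (cs⇔P b)))))

-- The middle sum as a combination of odd-index power sums

odd? : Decidable (λ s → s % 2 ≡ 1)
odd? s = s % 2 ≟ 1

-1*-1* : ∀ z → -1ℤ * (-1ℤ * z) ≡ z
-1*-1* = solve-∀

-1^-odd : ∀ s → s % 2 ≡ 1 → -1ℤ ^ s ≡ -1ℤ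
-1^-odd 1             _   = refl
-1^-odd (suc (suc s)) odd = trans (-1*-1* (-1ℤ ^ s)) (-1^-odd s odd)

-1^-even : ∀ s → s % 2 ≢ 1 → -1ℤ ^ s ≡ 1ℤ
-1^-even 0             _    = refl
-1^-even 1             even = ⊥-elim (even refl)
-1^-even (suc (suc s)) even = trans (-1*-1* (-1ℤ ^ s)) (-1^-even s even)

^-2*-∸ : ∀ x k s → s ≤ k → x ^ (2 ℕ.* k ∸ s) ≡ x ^ k * x ^ (k ∸ s)
^-2*-∸ x k s s≤k = begin
  x ^ (2 ℕ.* k ∸ s)     ≡⟨ cong (λ e → x ^ (k ℕ.+ e ∸ s)) (ℕP.+-identityʳ k) ⟩
  x ^ (k ℕ.+ k ∸ s)     ≡⟨ cong (x ^_) (ℕP.+-∸-assoc k s≤k) ⟩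
  x ^ (k ℕ.+ (k ∸ s))   ≡⟨ ℤP.^-distribˡ-+-* x k (k ∸ s) ⟩
  x ^ k * x ^ (k ∸ s)   ∎

binomialTerm-difference : ∀ (x c : ℤ) k s → s ≤ k →
  x ^ k * (c * (1ℤ ^ s * x ^ (k ∸ s)) - c * (-1ℤ ^ s * x ^ (k ∸ s)))
    ≡ (when (odd? s) (+ 2 * (c * x ^ (2 ℕ.* k ∸ s))))
binomialTerm-difference x c k s s≤k with odd? s
... | yes odd rewrite ℤP.^-zeroˡ s | -1^-odd s odd | ^-2*-∸ x k s s≤k = factor (x ^ k) c (x ^ (k ∸ s))
  where
  factor : ∀ a c b → a * (c * (1ℤ * b) - c * (-1ℤ * b)) ≡ + 2 * (c * (a * b))
  factor = solve-∀
... | no even rewrite ℤP.^-zeroˡ s | -1^-even s even = cancel (x ^ k) c (x ^ (k ∸ s))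
  where
  cancel : ∀ a c b → a * (c * (1ℤ * b) - c * (1ℤ * b)) ≡ + 0
  cancel = solve-∀

middleTerm-expansion : ∀ k (x : ℤ) →
  x ^ k * ((x + + 1) ^ k - (x - + 1) ^ k)
    ≡ + 2 * sumℤ (map (λ s → + (k C s) * x ^ (2 ℕ.* k ∸ s)) (oddsUpTo k))
middleTerm-expansion k x = begin
  x ^ k * ((x + + 1) ^ k - (x - + 1) ^ k)
    ≡⟨ cong₂ (λ a b → x ^ k * (a ^ k - b ^ k)) (ℤP.+-comm x 1ℤ) (ℤP.+-comm x -1ℤ) ⟩
  x ^ k * ((1ℤ + x) ^ k - (-1ℤ + x) ^ k)
    ≡⟨ cong₂ (λ a b → x ^ k * (a - b)) (binomial k 1ℤ x) (binomial k -1ℤ x) ⟩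
  x ^ k * (sum (term 1ℤ) - sum (term -1ℤ))
    ≡⟨ cong (x ^ k *_) (∑-distrib-− (suc k) (term 1ℤ) (term -1ℤ)) ⟨
  x ^ k * ∑[ s ≤ k ] (term 1ℤ s - term -1ℤ s)
    ≡⟨ *-distribˡ-sum (x ^ k) (λ s → term 1ℤ s - term -1ℤ s) ⟩
  ∑[ s ≤ k ] (x ^ k * (term 1ℤ s - term -1ℤ s))
    ≡⟨ sum-cong-≗ {suc k} (λ s →
         binomialTerm-difference x (+ (k C toℕ s)) k (toℕ s) (toℕ≤pred[n] s)) ⟩
  ∑[ s ≤ k ] (when (odd? (toℕ s)) (+ 2 * oddTerm (toℕ s)))
    ≡⟨ sumℤ-filter-upTo odd? (λ s → + 2 * oddTerm s) (suc k) ⟨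
  sumℤ (map (λ s → + 2 * oddTerm s) (oddsUpTo k))
    ≡⟨ sumℤ-*ˡ (+ 2) oddTerm (oddsUpTo k) ⟩
  + 2 * sumℤ (map oddTerm (oddsUpTo k)) ∎
  where
  term : ℤ → Vector ℤ (suc k)
  term a s = + (k C toℕ s) * (a ^ toℕ s * x ^ (k ∸ toℕ s))
  oddTerm : ℕ → ℤ
  oddTerm s = + (k C s) * x ^ (2 ℕ.* k ∸ s)

middleSum≡powerSumExpr : ∀ k λ' → middleSum k λ' ≡ powerSumExpr k λ'
middleSum≡powerSumExpr k λ' = begin
  middleSum k λ'
    ≡⟨ cong sumℤ (map-cong (middleTerm-expansion k ∘ +_) xs) ⟩
  sumℤ (map (λ x → + 2 * sumℤ (map (λ s → oddTerm s x) odds)) xs)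
    ≡⟨ sumℤ-*ˡ (+ 2) _ xs ⟩
  + 2 * sumℤ (map (λ x → sumℤ (map (λ s → oddTerm s x) odds)) xs)
    ≡⟨ cong (_*_ (+ 2)) (sumℤ-comm (λ x s → oddTerm s x) xs odds) ⟩
  + 2 * sumℤ (map (λ s → sumℤ (map (oddTerm s) xs)) odds)
    ≡⟨ cong (λ z → + 2 * sumℤ z) (map-cong (λ s → sumℤ-*ˡ (+ (k C s)) _ xs) odds) ⟩
  powerSumExpr k λ' ∎
  where
  xs = parts λ'
  odds = oddsUpTo k
  oddTerm : ℕ → ℕ → ℤ
  oddTerm s x = + (k C s) * (+ x) ^ (2 ℕ.* k ∸ s)

-- Shifted diagrams row by row

-- Row r (counting from 0) has length row xs r, which is 0 below the last row.
row : List ℕ → ℕ → ℕ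
row []       _       = 0
row (x ∷ _)  zero    = x
row (_ ∷ xs) (suc r) = row xs r

sumℤ-rows : ∀ (f : ℕ → ℤ) xs → sumℤ (map f xs) ≡ ∑[ r < length xs ] f (row xs (toℕ r))
sumℤ-rows f []       = refl
sumℤ-rows f (x ∷ xs) = cong (_+_ (f x)) (sumℤ-rows f xs)

lookup≡row : ∀ xs (n : Fin (length xs)) → lookup xs n ≡ row xs (toℕ n)
lookup≡row (x ∷ xs) Fin.zero    = refl
lookup≡row (x ∷ xs) (Fin.suc n) = lookup≡row xs n

row-length : ∀ xs → row xs (length xs) ≡ 0
row-length []       = refl
row-length (_ ∷ xs) = row-length xs

row>0⇒<length : ∀ xs r → 0 < row xs r → r < length xs
row>0⇒<length (x ∷ xs) zero    _ = s≤s z≤n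
row>0⇒<length (x ∷ xs) (suc r) p = s≤s (row>0⇒<length xs r p)

RowsDecrease : List ℕ → Set
RowsDecrease xs = ∀ r → 0 < row xs (suc r) → row xs (suc r) < row xs r

Linked⇒RowsDecrease : ∀ {xs} → Linked ℕ._>_ xs → RowsDecrease xs
Linked⇒RowsDecrease (x>y ∷ _)  zero    _ = x>y
Linked⇒RowsDecrease (_ ∷ x>ys) (suc r) p = Linked⇒RowsDecrease x>ys r p

RowsDecrease⇒Linked : ∀ {xs} → All (0 <_) xs → RowsDecrease xs → Linked ℕ._>_ xs
RowsDecrease⇒Linked []                _  = []
RowsDecrease⇒Linked (_ ∷ [])          _  = [-]
RowsDecrease⇒Linked (_ ∷ y>0 ∷ ys>0) dec = dec 0 y>0 ∷ RowsDecrease⇒Linked (y>0 ∷ ys>0) (dec ∘ suc)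

rowsDecrease : ∀ λ' → RowsDecrease (parts λ')
rowsDecrease λ' = Linked⇒RowsDecrease (decreasing λ')

-- box r t is the box of row r whose content is t.
box : ℕ → ℕ → Box
box r t = + suc r , + (suc r ℕ.+ t)

box-injective : ∀ {r t r' t'} → box r t ≡ box r' t' → r ≡ r' × t ≡ t'
box-injective {r} {t} {r'} {t'} eq with ℕP.suc-injective (ℤP.+-injective (cong proj₁ eq))
... | refl = refl , ℕP.+-cancelˡ-≡ (suc r) t t' (ℤP.+-injective (cong proj₂ eq))

content-box : ∀ r t → content (box r t) ≡ + t
content-box r t = begin
  + (suc r ℕ.+ t) - + suc r   ≡⟨ ℤP.[+m]-[+n]≡m⊖n (suc r ℕ.+ t) (suc r) ⟩
  (suc r ℕ.+ t) ℤ.⊖ suc r     ≡⟨ cong ((suc r ℕ.+ t) ℤ.⊖_) (ℕP.+-identityʳ (suc r)) ⟨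
  (suc r ℕ.+ t) ℤ.⊖ (suc r ℕ.+ 0) ≡⟨ ℤP.+-cancelˡ-⊖ (suc r) t 0 ⟩
  + t                          ∎

lastColumn : ∀ x r → + x + + suc r - + 1 ≡ + (x ℕ.+ r)
lastColumn x r rewrite ℕP.+-suc x r = refl

InRows : List ℕ → Box → Set
InRows xs b = ∃₂ λ r t → t < row xs r × b ≡ box r t

InRows-box : ∀ {xs r t} → InRows xs (box r t) → t < row xs r
InRows-box (_ , _ , t<row , eq) with box-injective eq
... | refl , refl = t<row

InS⇒InRows : ∀ λ' {b} → InS λ' b → InRows (parts λ') b
InS⇒InRows λ' {_ , + j} (n , refl , +≤+ r<j , j≤) =
  r , j ∸ suc r , t<row , cong (λ z → + suc r , + z) (sym (ℕP.m+[n∸m]≡n r<j))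
  where
  r = toℕ n
  x = row (parts λ') r
  j≤x+r : j ≤ x ℕ.+ r
  j≤x+r with subst (+ j ℤ.≤_) (trans (cong (λ y → + y + + suc r - + 1) (lookup≡row (parts λ') n))
                                      (lastColumn x r)) j≤
  ... | +≤+ j≤′ = j≤′
  t<row : j ∸ suc r < x
  t<row = ℕP.+-cancelˡ-≤ r (suc (j ∸ suc r)) x
            (subst₂ _≤_ (trans (sym (ℕP.m+[n∸m]≡n r<j)) (sym (ℕP.+-suc r (j ∸ suc r))))
                        (ℕP.+-comm x r) j≤x+r)
InS⇒InRows λ' {_ , -[1+ j ]} (n , refl , () , _)

InRows⇒InS : ∀ λ' {b} → InRows (parts λ') b → InS λ' b
InRows⇒InS λ' (r , t , t<row , refl) =
  n , cong (+_ ∘ suc) (sym toℕn≡r) , +≤+ (ℕP.m≤m+n (suc r) t) , last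
  where
  xs = parts λ'
  r<ℓ : r < length xs
  r<ℓ = row>0⇒<length xs r (ℕP.<-≤-trans (s≤s z≤n) t<row)
  n = fromℕ< r<ℓ
  toℕn≡r : toℕ n ≡ r
  toℕn≡r = toℕ-fromℕ< r<ℓ
  last : + (suc r ℕ.+ t) ℤ.≤ + lookup xs n + + suc r - + 1
  last rewrite lookup≡row xs n | toℕn≡r | lastColumn (row xs r) r =
    +≤+ (subst (suc r ℕ.+ t ≤_) (ℕP.+-comm r (row xs r))
          (subst (_≤ r ℕ.+ row xs r) (ℕP.+-suc r t) (ℕP.+-monoʳ-≤ r t<row)))

-- Inner and outer corners row by row

IsInnerRow : List ℕ → ℕ → Set
IsInnerRow xs zero    = ⊤
IsInnerRow xs (suc r) = 2 ℕ.+ row xs (suc r) ≤ row xs r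

isInnerRow? : ∀ xs → Decidable (IsInnerRow xs)
isInnerRow? xs zero    = yes tt
isInnerRow? xs (suc r) = 2 ℕ.+ row xs (suc r) ℕP.≤? row xs r

IsOuterRow : List ℕ → ℕ → Set
IsOuterRow xs r = 1 ≤ row xs r × (row xs (suc r) ≡ 0 ⊎ 2 ℕ.+ row xs (suc r) ≤ row xs r)

isOuterRow? : ∀ xs → Decidable (IsOuterRow xs)
isOuterRow? xs r =
  (1 ℕP.≤? row xs r) ×-dec ((row xs (suc r) ≟ 0) ⊎-dec (2 ℕ.+ row xs (suc r) ℕP.≤? row xs r))

innerCornerAt : List ℕ → ℕ → Box
innerCornerAt xs r = box r (row xs r)

outerCornerAt : List ℕ → ℕ → Box
outerCornerAt xs r = box r (pred (row xs r))

IsInnerRow⇒≤length : ∀ xs r → IsInnerRow xs r → r ≤ length xs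
IsInnerRow⇒≤length xs zero    _  = z≤n
IsInnerRow⇒≤length xs (suc r) le = row>0⇒<length xs r (ℕP.<-≤-trans (s≤s z≤n) le)

incrementAt : List ℕ → ℕ → List ℕ
incrementAt []       _       = 1 ∷ []
incrementAt (x ∷ xs) zero    = suc x ∷ xs
incrementAt (x ∷ xs) (suc r) = x ∷ incrementAt xs r

row-incrementAt-≡ : ∀ xs r → r ≤ length xs → row (incrementAt xs r) r ≡ suc (row xs r)
row-incrementAt-≡ []       zero    _         = refl
row-incrementAt-≡ (x ∷ xs) zero    _         = refl
row-incrementAt-≡ (x ∷ xs) (suc r) (s≤s r≤ℓ) = row-incrementAt-≡ xs r r≤ℓ

row-incrementAt-≢ : ∀ xs r r' → r ≤ length xs → r' ≢ r → row (incrementAt xs r) r' ≡ row xs r'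
row-incrementAt-≢ []       zero    zero     _         r'≢r = ⊥-elim (r'≢r refl)
row-incrementAt-≢ []       zero    (suc r') _         _    = refl
row-incrementAt-≢ (x ∷ xs) zero    zero     _         r'≢r = ⊥-elim (r'≢r refl)
row-incrementAt-≢ (x ∷ xs) zero    (suc r') _         _    = refl
row-incrementAt-≢ (x ∷ xs) (suc r) zero     _         _    = refl
row-incrementAt-≢ (x ∷ xs) (suc r) (suc r') (s≤s r≤ℓ) r'≢r =
  row-incrementAt-≢ xs r r' r≤ℓ (r'≢r ∘ cong suc)

incrementAt-positive : ∀ {xs} r → All (0 <_) xs → All (0 <_) (incrementAt xs r)
incrementAt-positive {[]}     r       _          = s≤s z≤n ∷ []
incrementAt-positive {x ∷ xs} zero    (_ ∷ xs>0) = s≤s z≤n ∷ xs>0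
incrementAt-positive {x ∷ xs} (suc r) (x>0 ∷ xs>0) = x>0 ∷ incrementAt-positive r xs>0

-- A row of length 1 disappears when its box is removed.
decrementAt : List ℕ → ℕ → List ℕ
decrementAt []           _       = []
decrementAt (x ∷ xs)     (suc r) = x ∷ decrementAt xs r
decrementAt (0 ∷ xs)     zero    = xs
decrementAt (1 ∷ xs)     zero    = xs
decrementAt (suc x ∷ xs) zero    = x ∷ xs

All-positive-row₀ : ∀ {xs} → All (0 <_) xs → row xs 0 ≡ 0 → xs ≡ []
All-positive-row₀ []         _  = refl
All-positive-row₀ (() ∷ _)   refl

row-decrementAt-≡ : ∀ xs r → IsOuterRow xs r → row (decrementAt xs r) r ≡ pred (row xs r)
row-decrementAt-≡ []                 _       (() , _)
row-decrementAt-≡ (0 ∷ xs)           zero    (() , _)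
row-decrementAt-≡ (1 ∷ xs)           zero    (_ , inj₁ row≡0)    = row≡0
row-decrementAt-≡ (1 ∷ xs)           zero    (_ , inj₂ (s≤s ()))
row-decrementAt-≡ (suc (suc x) ∷ xs) zero    _                   = refl
row-decrementAt-≡ (x ∷ xs)           (suc r) outer               = row-decrementAt-≡ xs r outer

row-decrementAt-≢ : ∀ xs r r' → All (0 <_) xs → IsOuterRow xs r → r' ≢ r →
  row (decrementAt xs r) r' ≡ row xs r'
row-decrementAt-≢ []                 _       _        _            _                   _    = refl
row-decrementAt-≢ (x ∷ xs)           zero    zero     _            _                   r'≢r =
  ⊥-elim (r'≢r refl)
row-decrementAt-≢ (0 ∷ xs)           zero    (suc r') _            (() , _)            _
row-decrementAt-≢ (1 ∷ xs)           zero    (suc r') (_ ∷ xs>0)   (_ , inj₁ row≡0)    _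
  rewrite All-positive-row₀ xs>0 row≡0 = refl
row-decrementAt-≢ (1 ∷ xs)           zero    (suc r') _            (_ , inj₂ (s≤s ())) _
row-decrementAt-≢ (suc (suc x) ∷ xs) zero    (suc r') _            _                   _    = refl
row-decrementAt-≢ (x ∷ xs)           (suc r) zero     _            _                   _    = refl
row-decrementAt-≢ (x ∷ xs)           (suc r) (suc r') (_ ∷ xs>0)   outer               r'≢r =
  row-decrementAt-≢ xs r r' xs>0 outer (r'≢r ∘ cong suc)

decrementAt-positive : ∀ {xs} r → All (0 <_) xs → All (0 <_) (decrementAt xs r)
decrementAt-positive {[]}               r       _            = []
decrementAt-positive {0 ∷ xs}           zero    (_ ∷ xs>0)   = xs>0
decrementAt-positive {1 ∷ xs}           zero    (_ ∷ xs>0)   = xs>0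
decrementAt-positive {suc (suc x) ∷ xs} zero    (_ ∷ xs>0)   = s≤s z≤n ∷ xs>0
decrementAt-positive {x ∷ xs}           (suc r) (x>0 ∷ xs>0) = x>0 ∷ decrementAt-positive r xs>0

IsInnerRow-intro : ∀ xs r → (∀ {r'} → r ≡ suc r' → 2 ℕ.+ row xs r ≤ row xs r') → IsInnerRow xs r
IsInnerRow-intro xs zero    _     = tt
IsInnerRow-intro xs (suc r) above = above refl

innerCorner⇒innerRow : ∀ λ' {b} → IsInnerCorner λ' b →
  Σ ℕ λ r → r < suc (length (parts λ')) × IsInnerRow (parts λ') r × b ≡ innerCornerAt (parts λ') r
innerCorner⇒innerRow λ' {b} (b∉λ , μ , μ≈λ∪b)
  with r , t , t<μ , refl ← InS⇒InRows μ (Equivalence.from (μ≈λ∪b b) (inj₂ refl)) =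
  r , s≤s (IsInnerRow⇒≤length xs r inner) , inner , cong (box r) t≡λ
  where
  xs = parts λ'
  ys = parts μ

  μ⊆λ∪b : ∀ {r' u} → u < row ys r' → u < row xs r' ⊎ (r' ≡ r × u ≡ t)
  μ⊆λ∪b {r'} {u} u<μ with Equivalence.to (μ≈λ∪b (box r' u)) (InRows⇒InS μ (r' , u , u<μ , refl))
  ... | inj₁ inλ = inj₁ (InRows-box {xs} (InS⇒InRows λ' inλ))
  ... | inj₂ eq  = inj₂ (box-injective eq)

  t≡λ : t ≡ row xs r
  t≡λ with ℕP.<-cmp t (row xs r)
  ... | tri< t<λ _ _ = ⊥-elim (b∉λ (InRows⇒InS λ' (r , t , t<λ , refl)))
  ... | tri≈ _ t≡λ _ = t≡λ
  ... | tri> _ _ λ<t with μ⊆λ∪b (ℕP.<-trans λ<t t<μ)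
  ...   | inj₁ λ<λ       = ⊥-elim (ℕP.<-irrefl refl λ<λ)
  ...   | inj₂ (_ , λ≡t) = ⊥-elim (ℕP.<-irrefl λ≡t λ<t)

  μ≤λ : ∀ r' → r' ≢ r → row ys r' ≤ row xs r'
  μ≤λ r' r'≢r = ℕP.≮⇒≥ λ λ<μ → [ ℕP.<-irrefl refl , r'≢r ∘ proj₁ ]′ (μ⊆λ∪b λ<μ)

  inner : IsInnerRow xs r
  inner = IsInnerRow-intro xs r above
    where
    above : ∀ {r'} → r ≡ suc r' → 2 ℕ.+ row xs r ≤ row xs r'
    above {r'} refl =
      subst (λ u → 2 ℕ.+ u ≤ row xs r') t≡λ
        (ℕP.≤-trans (s≤s t<μ)
          (ℕP.≤-trans (rowsDecrease μ r' (ℕP.<-≤-trans (s≤s z≤n) t<μ)) (μ≤λ r' λ ())))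

outerCorner⇒outerRow : ∀ λ' {b} → IsOuterCorner λ' b →
  Σ ℕ λ r → r < length (parts λ') × IsOuterRow (parts λ') r × b ≡ outerCornerAt (parts λ') r
outerCorner⇒outerRow λ' (b∈λ , μ , μ≈λ∖b)
  with r , t , t<λ , refl ← InS⇒InRows λ' b∈λ =
  r , row>0⇒<length xs r (ℕP.<-≤-trans (s≤s z≤n) t<λ) ,
  (ℕP.<-≤-trans (s≤s z≤n) t<λ , below) , cong (box r ∘ pred) 1+t≡λ
  where
  xs = parts λ'
  ys = parts μ

  λ⊆μ∪b : ∀ {r' u} → u < row xs r' → u < row ys r' ⊎ (r' ≡ r × u ≡ t)
  λ⊆μ∪b {r'} {u} u<λ with (r' ≟ r) ×-dec (u ≟ t)
  ... | yes r'u≡rt = inj₂ r'u≡rt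
  ... | no  r'u≢rt = inj₁ (InRows-box {ys} (InS⇒InRows μ (Equivalence.from (μ≈λ∖b (box r' u))
                       (InRows⇒InS λ' (r' , u , u<λ , refl) , r'u≢rt ∘ box-injective))))

  t≮μ : ¬ t < row ys r
  t≮μ t<μ = proj₂ (Equivalence.to (μ≈λ∖b (box r t)) (InRows⇒InS μ (r , t , t<μ , refl))) refl

  1+t≡λ : suc t ≡ row xs r
  1+t≡λ = ℕP.≤-antisym t<λ (ℕP.≮⇒≥ λ 1+t<λ →
    [ t≮μ ∘ ℕP.<-trans (ℕP.n<1+n t) , (λ ()) ∘ proj₂ ]′ (λ⊆μ∪b 1+t<λ))

  λ≤μ : ∀ r' → r' ≢ r → row xs r' ≤ row ys r'
  λ≤μ r' r'≢r = ℕP.≮⇒≥ λ μ<λ → [ ℕP.<-irrefl refl , r'≢r ∘ proj₁ ]′ (λ⊆μ∪b μ<λ)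

  below : row xs (suc r) ≡ 0 ⊎ 2 ℕ.+ row xs (suc r) ≤ row xs r
  below with row xs (suc r) ≟ 0
  ... | yes λ≡0 = inj₁ λ≡0
  ... | no  λ≢0 = inj₂ (subst (2 ℕ.+ row xs (suc r) ≤_) 1+t≡λ
    (s≤s (ℕP.≤-<-trans (λ≤μ (suc r) λ ())
      (ℕP.<-≤-trans (rowsDecrease μ r (ℕP.<-≤-trans (ℕP.n≢0⇒n>0 λ≢0) (λ≤μ (suc r) λ ())))
        (ℕP.≮⇒≥ t≮μ)))))

module _ (λ' : StrictPartition) {r : ℕ} (inner : IsInnerRow (parts λ') r) where
  private
    xs = parts λ'
    zs = incrementAt xs r
    r≤ℓ : r ≤ length xs
    r≤ℓ = IsInnerRow⇒≤length xs r inner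
    row-zs-≡ : row zs r ≡ suc (row xs r)
    row-zs-≡ = row-incrementAt-≡ xs r r≤ℓ
    row-zs-≢ : ∀ {r'} → r' ≢ r → row zs r' ≡ row xs r'
    row-zs-≢ = row-incrementAt-≢ xs r _ r≤ℓ

  rowsDecrease-incrementAt : RowsDecrease zs
  rowsDecrease-incrementAt r' p with r' ≟ r
  ... | yes refl rewrite row-zs-≢ {suc r} (λ ()) | row-zs-≡ =
    ℕP.m<n⇒m<1+n (rowsDecrease λ' r (subst (0 <_) (row-zs-≢ (λ ())) p))
  ... | no r'≢r with suc r' ≟ r
  ...   | yes refl  rewrite row-zs-≢ r'≢r | row-zs-≡ = inner
  ...   | no 1+r'≢r rewrite row-zs-≢ r'≢r | row-zs-≢ 1+r'≢r = rowsDecrease λ' r' p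

  row≤row-incrementAt : ∀ r' → row xs r' ≤ row zs r'
  row≤row-incrementAt r' with r' ≟ r
  ... | yes refl rewrite row-zs-≡    = ℕP.n≤1+n _
  ... | no r'≢r  rewrite row-zs-≢ r'≢r = ℕP.≤-refl

  incrementAt-diagram : ∀ {c} → InRows zs c → InS λ' c ⊎ c ≡ innerCornerAt xs r
  incrementAt-diagram (r' , t , t<z , refl) with r' ≟ r
  ... | no r'≢r = inj₁ (InRows⇒InS λ' (r' , t , subst (t <_) (row-zs-≢ r'≢r) t<z , refl))
  ... | yes refl with t ℕP.<? row xs r
  ...   | yes t<λ = inj₁ (InRows⇒InS λ' (r , t , t<λ , refl))
  ...   | no  t≮λ = inj₂ (cong (box r) (ℕP.≤-antisym
                      (ℕP.<⇒≤pred (subst (t <_) row-zs-≡ t<z)) (ℕP.≮⇒≥ t≮λ)))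

  innerRow⇒innerCorner : IsInnerCorner λ' (innerCornerAt xs r)
  innerRow⇒innerCorner =
    corner∉λ , μ , λ c → mk⇔ (incrementAt-diagram ∘ InS⇒InRows μ) (InRows⇒InS μ ∘ into-μ)
    where
    corner∉λ : ¬ InS λ' (innerCornerAt xs r)
    corner∉λ = ℕP.<-irrefl refl ∘ InRows-box {xs} ∘ InS⇒InRows λ'
    positive-zs = incrementAt-positive r (positive λ')
    μ : StrictPartition
    μ = sp zs (RowsDecrease⇒Linked positive-zs rowsDecrease-incrementAt) positive-zs
    into-μ : ∀ {c} → InS λ' c ⊎ c ≡ innerCornerAt xs r → InRows zs c
    into-μ (inj₁ c∈λ) with r' , t , t<λ , refl ← InS⇒InRows λ' c∈λ =
      r' , t , ℕP.<-≤-trans t<λ (row≤row-incrementAt r') , refl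
    into-μ (inj₂ refl) = r , row xs r , subst (row xs r <_) (sym row-zs-≡) (ℕP.n<1+n _) , refl

module _ (λ' : StrictPartition) {r : ℕ} (outer : IsOuterRow (parts λ') r) where
  private
    xs = parts λ'
    zs = decrementAt xs r
    row-zs-≡ : row zs r ≡ pred (row xs r)
    row-zs-≡ = row-decrementAt-≡ xs r outer
    row-zs-≢ : ∀ {r'} → r' ≢ r → row zs r' ≡ row xs r'
    row-zs-≢ = row-decrementAt-≢ xs r _ (positive λ') outer

  rowsDecrease-decrementAt : RowsDecrease zs
  rowsDecrease-decrementAt r' p with r' ≟ r
  ... | yes refl rewrite row-zs-≢ {suc r} (λ ()) | row-zs-≡ with proj₂ outer
  ...   | inj₁ row≡0 = ⊥-elim (ℕP.<-irrefl (sym row≡0) (subst (0 <_) (row-zs-≢ (λ ())) p))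
  ...   | inj₂ 2+λ≤λ = ℕP.<⇒≤pred 2+λ≤λ
  rowsDecrease-decrementAt r' p | no r'≢r with suc r' ≟ r
  ...   | yes refl  rewrite row-zs-≢ r'≢r | row-zs-≡ =
    ℕP.≤-<-trans ℕP.pred[n]≤n (rowsDecrease λ' r' (proj₁ outer))
  ...   | no 1+r'≢r rewrite row-zs-≢ r'≢r | row-zs-≢ 1+r'≢r = rowsDecrease λ' r' p

  decrementAt-diagram : ∀ {c} → InRows zs c → InS λ' c × c ≢ outerCornerAt xs r
  decrementAt-diagram (r' , t , t<z , refl) with r' ≟ r
  ... | no r'≢r = InRows⇒InS λ' (r' , t , subst (t <_) (row-zs-≢ r'≢r) t<z , refl) ,
                  r'≢r ∘ proj₁ ∘ box-injective
  ... | yes refl = InRows⇒InS λ' (r , t , ℕP.<-≤-trans t<pred ℕP.pred[n]≤n , refl) ,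
                   flip ℕP.<-irrefl t<pred ∘ proj₂ ∘ box-injective
    where
    t<pred : t < pred (row xs r)
    t<pred = subst (t <_) row-zs-≡ t<z

  outerRow⇒outerCorner : IsOuterCorner λ' (outerCornerAt xs r)
  outerRow⇒outerCorner =
    corner∈λ , μ , λ c → mk⇔ (decrementAt-diagram ∘ InS⇒InRows μ) (InRows⇒InS μ ∘ into-μ)
    where
    corner∈λ : InS λ' (outerCornerAt xs r)
    corner∈λ = InRows⇒InS λ'
      (r , pred (row xs r) , ℕP.m≤pred[n]⇒suc[m]≤n {{ℕ.>-nonZero (proj₁ outer)}} ℕP.≤-refl , refl)
    positive-zs = decrementAt-positive r (positive λ')
    μ : StrictPartition
    μ = sp zs (RowsDecrease⇒Linked positive-zs rowsDecrease-decrementAt) positive-zs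
    into-μ : ∀ {c} → InS λ' c × c ≢ outerCornerAt xs r → InRows zs c
    into-μ (c∈λ , c≢corner) with r' , t , t<λ , refl ← InS⇒InRows λ' c∈λ with r' ≟ r
    ... | no r'≢r = r' , t , subst (t <_) (sym (row-zs-≢ r'≢r)) t<λ , refl
    ... | yes refl = r , t , subst (t <_) (sym row-zs-≡)
                       (ℕP.≤∧≢⇒< (ℕP.<⇒≤pred t<λ) (c≢corner ∘ cong (box r))) , refl

Enumerates-map-filter-upTo : ∀ {P : Box → Set} {q} {Q : Pred ℕ q} (Q? : Decidable Q) (f : ℕ → Box) n →
  (∀ {r r'} → f r ≡ f r' → r ≡ r') →
  (∀ {b} → P b → Σ ℕ λ r → r < n × Q r × b ≡ f r) →
  (∀ {r} → Q r → P (f r)) →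
  Enumerates P (map f (filter Q? (upTo n)))
Enumerates-map-filter-upTo {P} Q? f n f-injective P⇒Q Q⇒P =
  Unique.map⁺ f-injective (Unique.filter⁺ Q? (Unique.upTo⁺ n)) ,
  λ b → mk⇔ (from-list b) (into-list b)
  where
  from-list : ∀ b → b ∈ map f (filter Q? (upTo n)) → P b
  from-list b b∈ with _ , _ , refl , q ← ∈-map∘filter⁻ f Q? {xs = upTo n} b∈ = Q⇒P q
  into-list : ∀ b → P b → b ∈ map f (filter Q? (upTo n))
  into-list b pb with r , r<n , q , refl ← P⇒Q pb = ∈-map∘filter⁺ f Q? (r , ∈-upTo⁺ r<n , refl , q)

innerCorners outerCorners : List ℕ → List Box
innerCorners xs = map (innerCornerAt xs) (filter (isInnerRow? xs) (upTo (suc (length xs))))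
outerCorners xs = map (outerCornerAt xs) (filter (isOuterRow? xs) (upTo (length xs)))

innerCorners-enumerates : ∀ λ' → Enumerates (IsInnerCorner λ') (innerCorners (parts λ'))
innerCorners-enumerates λ' = Enumerates-map-filter-upTo (isInnerRow? xs) (innerCornerAt xs) (suc (length xs))
  (proj₁ ∘ box-injective) (innerCorner⇒innerRow λ') (innerRow⇒innerCorner λ')
  where xs = parts λ'

outerCorners-enumerates : ∀ λ' → Enumerates (IsOuterCorner λ') (outerCorners (parts λ'))
outerCorners-enumerates λ' = Enumerates-map-filter-upTo (isOuterRow? xs) (outerCornerAt xs) (length xs)
  (proj₁ ∘ box-injective) (outerCorner⇒outerRow λ') (outerRow⇒outerCorner λ')
  where xs = parts λ'

sumℤ-map-filter-upTo : ∀ {A : Set} {q} {Q : Pred ℕ q} (w : A → ℤ) (Q? : Decidable Q) (f : ℕ → A) n →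
  sumℤ (map w (map f (filter Q? (upTo n))))
    ≡ ∑[ r < n ] (when (Q? (toℕ r)) (w (f (toℕ r))))
sumℤ-map-filter-upTo w Q? f n =
  trans (cong sumℤ (sym (map-∘ (filter Q? (upTo n))))) (sumℤ-filter-upTo Q? (w ∘ f) n)

innerContribution outerContribution : ℕ → List ℕ → ℕ → ℤ
innerContribution k xs r = when (isInnerRow? xs r) (cornerWeight k (innerCornerAt xs r))
outerContribution k xs r = when (isOuterRow? xs r) (cornerWeight k (outerCornerAt xs r))

ψ-by-rows : ∀ k λ' {I O} → Enumerates (IsInnerCorner λ') I → Enumerates (IsOuterCorner λ') O →
  let xs = parts λ' ; ℓ = length xs in
  ψ k I O ≡ ∑[ r < suc ℓ ] innerContribution k xs (toℕ r) - ∑[ r < ℓ ] outerContribution k xs (toℕ r)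
ψ-by-rows k λ' I-enum O-enum = cong₂ _-_
  (trans (enumerations-sum (cornerWeight k) I-enum (innerCorners-enumerates λ'))
         (sumℤ-map-filter-upTo (cornerWeight k) (isInnerRow? xs) (innerCornerAt xs) (suc (length xs))))
  (trans (enumerations-sum (cornerWeight k) O-enum (outerCorners-enumerates λ'))
         (sumℤ-map-filter-upTo (cornerWeight k) (isOuterRow? xs) (outerCornerAt xs) (length xs)))
  where xs = parts λ'

-- Telescoping the corner weights

weight : ℕ → ℕ → ℤ
weight k t = (+ t * (+ t + + 1)) ^ k

cornerWeight-box : ∀ k r t → cornerWeight k (box r t) ≡ weight k t
cornerWeight-box k r t = cong (λ c → (c * (c + + 1)) ^ k) (content-box r t)

weight-zero : ∀ {k} → k ≥ 1 → weight k 0 ≡ + 0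
weight-zero {suc k} _ = refl

weight-difference : ∀ {k} → k ≥ 1 → ∀ x →
  weight k x - weight k (pred x) ≡ (+ x) ^ k * ((+ x + + 1) ^ k - (+ x - + 1) ^ k)
weight-difference {suc k} _ zero    = refl
weight-difference {k}     _ (suc m) = begin
  weight k (suc m) - (+ m * (+ m + + 1)) ^ k
    ≡⟨ cong (λ z → weight k (suc m) - (+ m * + z) ^ k) (ℕP.+-comm m 1) ⟩
  (+ suc m * (+ suc m + + 1)) ^ k - (+ m * + suc m) ^ k
    ≡⟨ cong₂ _-_ (^-distrib-* (+ suc m) (+ suc m + + 1) k) (^-distrib-* (+ m) (+ suc m) k) ⟩
  (+ suc m) ^ k * (+ suc m + + 1) ^ k - (+ m) ^ k * (+ suc m) ^ k
    ≡⟨ factor ((+ suc m) ^ k) ((+ suc m + + 1) ^ k) ((+ m) ^ k) ⟩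
  (+ suc m) ^ k * ((+ suc m + + 1) ^ k - (+ m) ^ k) ∎
  where
  factor : ∀ a b c → a * b - c * a ≡ a * (b - c)
  factor = solve-∀

adjacent-rows : ∀ {x y} → (0 < y → y < x) →
  ¬ 2 ℕ.+ y ≤ x → ¬ (1 ≤ x × (y ≡ 0 ⊎ 2 ℕ.+ y ≤ x)) → y ≡ pred x
adjacent-rows {zero}  {zero}  _      _      _      = refl
adjacent-rows {zero}  {suc y} y<x    _      _      = ⊥-elim (ℕP.n≮0 (y<x (s≤s z≤n)))
adjacent-rows {suc x} {zero}  _      _      ¬outer = ⊥-elim (¬outer (s≤s z≤n , inj₁ refl))
adjacent-rows {suc x} {suc y} y<x    ¬inner _      =
  ℕP.≤-antisym (ℕP.≤-pred (y<x (s≤s z≤n))) (ℕP.≤-pred (ℕP.≤-pred (ℕP.≰⇒> ¬inner)))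

corner-pairing : ∀ {k} → k ≥ 1 → ∀ λ' r →
  innerContribution k (parts λ') (suc r) - outerContribution k (parts λ') r
    ≡ weight k (row (parts λ') (suc r)) - weight k (pred (row (parts λ') r))
corner-pairing {k} k≥1 λ' r with isInnerRow? xs (suc r) | isOuterRow? xs r
  where xs = parts λ'
... | yes _      | yes _                = cong₂ _-_ (cornerWeight-box k (suc r) _) (cornerWeight-box k r _)
... | yes inner  | no ¬outer            = ⊥-elim (¬outer (ℕP.<-≤-trans (s≤s z≤n) inner , inj₂ inner))
... | no ¬inner  | yes (_ , inj₂ inner) = ⊥-elim (¬inner inner)
... | no _       | yes (_ , inj₁ λ≡0)  =
  cong₂ _-_ (sym (trans (cong (weight k) λ≡0) (weight-zero k≥1))) (cornerWeight-box k r _)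
... | no ¬inner  | no ¬outer            = begin
  + 0 - + 0                                       ≡⟨ ℤP.+-inverseʳ (weight k (pred x)) ⟨
  weight k (pred x) - weight k (pred x)
    ≡⟨ cong (λ y → weight k y - weight k (pred x)) (adjacent-rows (rowsDecrease λ' r) ¬inner ¬outer) ⟨
  weight k (row (parts λ') (suc r)) - weight k (pred x) ∎
  where x = row (parts λ') r

rowContributions-telescope : ∀ {k} → k ≥ 1 → ∀ λ' → let xs = parts λ' ; ℓ = length xs in
  ∑[ r < suc ℓ ] innerContribution k xs (toℕ r) - ∑[ r < ℓ ] outerContribution k xs (toℕ r)
    ≡ middleSum k λ'
rowContributions-telescope {k} k≥1 λ' = begin
  inner 0 + ∑[ r < ℓ ] inner (suc (toℕ r)) - ∑[ r < ℓ ] outer (toℕ r)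
    ≡⟨ ℤP.+-assoc (inner 0) _ _ ⟩
  inner 0 + (∑[ r < ℓ ] inner (suc (toℕ r)) - ∑[ r < ℓ ] outer (toℕ r))
    ≡⟨ cong (_+_ (inner 0)) (∑-distrib-− ℓ _ _) ⟨
  inner 0 + ∑[ r < ℓ ] (inner (suc (toℕ r)) - outer (toℕ r))
    ≡⟨ cong₂ _+_ (cornerWeight-box k 0 (row xs 0)) (sum-cong-≗ {ℓ} (corner-pairing k≥1 λ' ∘ toℕ)) ⟩
  f 0 + ∑[ r < ℓ ] (f (suc (toℕ r)) - g (toℕ r))
    ≡⟨ ∑-telescope ℓ f g ⟩
  ∑[ r < ℓ ] (f (toℕ r) - g (toℕ r)) + f ℓ
    ≡⟨ cong (_+_ (∑[ r < ℓ ] (f (toℕ r) - g (toℕ r))))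
            (trans (cong (weight k) (row-length xs)) (weight-zero k≥1)) ⟩
  ∑[ r < ℓ ] (f (toℕ r) - g (toℕ r)) + + 0
    ≡⟨ ℤP.+-identityʳ _ ⟩
  ∑[ r < ℓ ] (f (toℕ r) - g (toℕ r))
    ≡⟨ sumℤ-rows (λ x → weight k x - weight k (pred x)) xs ⟨
  sumℤ (map (λ x → weight k x - weight k (pred x)) xs)
    ≡⟨ cong sumℤ (map-cong (weight-difference k≥1) xs) ⟩
  middleSum k λ' ∎
  where
  xs = parts λ'
  ℓ = length xs
  inner outer : ℕ → ℤ
  inner = innerContribution k xs
  outer = outerContribution k xs
  f g : ℕ → ℤ
  f r = weight k (row xs r)
  g r = weight k (pred (row xs r))

proposition6p2 : (k : ℕ) → k ≥ 1 → (λ' : StrictPartition) →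
    (I O : List Box) → Enumerates (IsInnerCorner λ') I → Enumerates (IsOuterCorner λ') O →
    (ψ k I O ≡ middleSum k λ') × (middleSum k λ' ≡ powerSumExpr k λ')
proposition6p2 k k≥1 λ' I O I-enum O-enum =
  trans (ψ-by-rows k λ' I-enum O-enum) (rowContributions-telescope k≥1 λ') , middleSum≡powerSumExpr k λ'
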